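{- If a finite simple graph $G$ has a $\{P_{2},P_{5}\}$-factor, then $c_{1}(G-X)+\frac{1}{2}c_{3}(G-X)\leq \frac{3}{2}|X|$ for all $X\subseteq V(G)$.
   Context: For a graph $H$ and an integer $i\geq 1$, $c_{i}(H)$ denotes the number of connected components of $H$ having exactly $i$ vertices. $P_{n}$ denotes the path on $n$ vertices. A $\{P_{2},P_{5}\}$-factor of a graph is a spanning subgraph each of whose components is isomorphic to $P_{2}$ or $P_{5}$. -}

module Defs where

open import Data.Nat using (ℕ; zero; suc; _≡ᵇ_)
open import Data.Bool using (Bool; true; false; _∧_; _∨_; not; if_then_else_)
open import Data.Fin using (Fin; toℕ)
open import Data.Fin.Subset using (Subset; _∩_; _∪_; ∁; _─_; ∣_∣)
open import Data.Vec using (Vec; []; _∷_; lookup)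
open import Data.List using (List; []; _∷_; map; _++_; allFin; filter; length)
open import Data.Bool.ListAction using (any; all)
open import Data.Product using (Σ; _×_; _,_)
open import Data.Sum using (_⊎_)
open import Function.Definitions using (Injective)
open import Relation.Binary.PropositionalEquality using (_≡_)
open import Relation.Nullary.Decidable using (does)
open import Data.Bool.Properties using (T?)
open import Data.Bool using (T)

record Graph (n : ℕ) : Set where
  field
    adj    : Fin n → Fin n → Bool
    sym    : ∀ u v → adj u v ≡ adj v u
    irrefl : ∀ v → adj v v ≡ false
open Graph public

record PathIn {n : ℕ} (G : Graph n) (k : ℕ) : Set where
  field
    vert        : Fin k → Fin n
    injective   : Injective _≡_ _≡_ vert
    consecutive : ∀ (i j : Fin k) → toℕ j ≡ suc (toℕ i) →
                  adj G (vert i) (vert j) ≡ true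
open PathIn public

-- A {P₂,P₅}-factor: a family of vertex-disjoint paths of G, each on 2 or
-- 5 vertices, covering every vertex exactly once.  (The spanning
-- subgraph is the union of the edges of these paths.)
record P2P5Factor {n : ℕ} (G : Graph n) : Set where
  field
    m       : ℕ
    size    : Fin m → ℕ
    size25  : ∀ p → size p ≡ 2 ⊎ size p ≡ 5
    path    : (p : Fin m) → PathIn G (size p)
    cover   : ∀ (v : Fin n) → Σ (Σ (Fin m) (λ p → Fin (size p)))
                (λ { (p , i) → vert (path p) i ≡ v })
    unique  : ∀ (p q : Fin m) (i : Fin (size p)) (j : Fin (size q)) →
              vert (path p) i ≡ vert (path q) j →
              _≡_ {A = Σ (Fin m) (λ r → Fin (size r))} (p , i) (q , j)

allSubsets : ∀ n → List (Subset n)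
allSubsets zero    = [] ∷ []
allSubsets (suc n) = map (true ∷_) (allSubsets n) ++ map (false ∷_) (allSubsets n)

module _ {n : ℕ} (G : Graph n) where

  _∈ᵇ_ : Fin n → Subset n → Bool
  v ∈ᵇ S = lookup S v

  nonemptyᵇ : Subset n → Bool
  nonemptyᵇ S = any (_∈ᵇ S) (allFin n)

  _⊆ᵇ_ : Subset n → Subset n → Bool
  S ⊆ᵇ T = all (λ v → not (v ∈ᵇ S) ∨ (v ∈ᵇ T)) (allFin n)

  _≡ˢ_ : Subset n → Subset n → Bool
  S ≡ˢ T = (S ⊆ᵇ T) ∧ (T ⊆ᵇ S)

  edgeBetween : Subset n → Subset n → Bool
  edgeBetween S T =
    any (λ u → any (λ v → (u ∈ᵇ S) ∧ (v ∈ᵇ T) ∧ adj G u v) (allFin n)) (allFin n)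

  connectedᵇ : Subset n → Bool
  connectedᵇ C =
    all (λ S → not ((S ⊆ᵇ C) ∧ nonemptyᵇ S ∧ not (S ≡ˢ C))
               ∨ edgeBetween S (C ─ S))
        (allSubsets n)

  isComponentᵇ : Subset n → Subset n → Bool
  isComponentᵇ X C =
    nonemptyᵇ C ∧ not (nonemptyᵇ (C ∩ X)) ∧ connectedᵇ C
      ∧ not (edgeBetween C (∁ (C ∪ X)))

  c : ℕ → Subset n → ℕ
  c i X = length (filter (λ C → T? (isComponentᵇ X C ∧ (∣ C ∣ ≡ᵇ i)))
                         (allSubsets n))

-- Discharging.  Every vertex of X holds 3 units and sends them along the factor: a
-- vertex outside X receives 1 from each factor-neighbour in X, or 2 if it is an end of
-- its factor path.  Since the factor has no P₃, no vertex of X pays more than 3.  A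
-- singleton component {v} of G − X has all its factor-neighbours in X, so v receives
-- exactly 2.  A component of G − X with 3 vertices is not a union of factor paths (they
-- have 2 or 5 vertices), so a factor edge leaves it, necessarily into X, and one of its
-- vertices receives at least 1.  Components are disjoint, hence 2c₁ + c₃ ≤ 3|X|.

module Submission where

open import Data.Bool using (Bool; true; false; T; not; _∧_; _∨_; if_then_else_)
open import Data.Bool.ListAction using (any; all)
open import Data.Bool.Properties using (T?; T-≡; T-∧; T-∨)
open import Data.Empty using (⊥; ⊥-elim)
open import Data.Fin using (Fin; zero; suc; toℕ; _≟_)
open import Data.Fin.Patterns using (0F; 1F; 2F; 3F; 4F)
import Data.Fin.Properties as Finₚ
open import Data.Fin.Subset using (Subset; Nonempty; ∣_∣; ⁅_⁆; _∩_; _∪_; ∁; _─_; outside)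
  renaming (_∈_ to _∈ₛ_; _∉_ to _∉ₛ_; _⊆_ to _⊆ₛ_)
open import Data.Fin.Subset.Properties
  using (_∈?_; x∈p∩q⁺; p∩q⊆p; p∩q⊆q; x∈p∪q⁻; x∉p⇒x∈∁p; p─q⊆p; ⊆-antisym;
         ∣⁅x⁆∣≡1; x∈⁅y⁆⇒x≡y; x≢y⇒x∉⁅y⁆; p⊂q⇒∣p∣<∣q∣)
open import Data.List using (List; []; _∷_; map; filter; length; _++_; allFin)
open import Data.List.Membership.Propositional using (_∈_)
open import Data.List.Membership.Propositional.Properties using (∈-map⁺; ∈-++⁺ˡ; ∈-++⁺ʳ; ∈-allFin)
open import Data.List.Properties using (map-++; map-∘)
import Data.List.Relation.Unary.All as All
open import Data.List.Relation.Unary.All.Properties using (all⁺; all⁻)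
import Data.List.Relation.Unary.Any as Any
open import Data.List.Relation.Unary.Any.Properties using (any⁺; any⁻)
open import Data.Nat using (ℕ; zero; suc; _+_; _*_; _≤_; _<_; z≤n; s≤s; _≡ᵇ_; _≤ᵇ_)
open import Data.Nat.ListAction using (sum)
open import Data.Nat.ListAction.Properties using (sum-++)
open import Data.Nat.Properties hiding (_≟_)
open import Algebra.Properties.CommutativeSemigroup +-commutativeSemigroup
  using () renaming (interchange to +-interchange)
open import Algebra.Properties.Semiring.Sum +-*-semiring
  using (sum-syntax; sum-cong-≗; sum-replicate-zero; ∑-distrib-+; ∑-comm;
         *-distribˡ-sum; *-distribʳ-sum)
open import Data.Product using (Σ; ∃; ∃₂; _×_; _,_; proj₁; proj₂)
open import Data.Sum using (_⊎_; inj₁; inj₂; [_,_]; reduce)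
open import Data.Vec using (Vec; []; _∷_; lookup; tabulate; here; there)
open import Data.Vec.Properties
  using (∷-injectiveˡ; ∷-injectiveʳ; lookup∘tabulate; []=⇒lookup; lookup⇒[]=)
open import Function using (_∘_; Equivalence)
open import Relation.Binary.PropositionalEquality hiding ([_])
open import Relation.Nullary using (¬_; yes; no; does)
open import Defs renaming (sym to adj-sym)

true≢false : true ≢ false
true≢false ()

ind : Bool → ℕ
ind true  = 1
ind false = 0

ind≤1 : ∀ b → ind b ≤ 1
ind≤1 true  = ≤-refl
ind≤1 false = z≤n

ind-T : ∀ {b} → T b → ind b ≡ 1
ind-T {true} _ = refl

ind-positive : ∀ {b} → 0 < ind b → T b
ind-positive {true} _ = _

T-not⇒¬T : ∀ {b} → T (not b) → ¬ T b
T-not⇒¬T {false} _ ()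

∑-mono-≤ : ∀ {n} {f g : Fin n → ℕ} → (∀ i → f i ≤ g i) → ∑[ i < n ] f i ≤ ∑[ i < n ] g i
∑-mono-≤ {zero}  f≤g = z≤n
∑-mono-≤ {suc n} f≤g = +-mono-≤ (f≤g zero) (∑-mono-≤ (λ i → f≤g (suc i)))

f≤∑f : ∀ {n} (f : Fin n → ℕ) i → f i ≤ ∑[ j < n ] f j
f≤∑f f zero    = m≤m+n _ _
f≤∑f f (suc i) = ≤-trans (f≤∑f (λ j → f (suc j)) i) (m≤n+m _ _)

∑-positive : ∀ {n} (f : Fin n → ℕ) → 0 < ∑[ i < n ] f i → ∃ λ i → 0 < f i
∑-positive {suc n} f 0<∑ with f zero in eq
... | suc _ = zero , subst (0 <_) (sym eq) (s≤s z≤n)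
... | zero  = let i , 0<fi = ∑-positive (λ j → f (suc j)) 0<∑ in suc i , 0<fi

+-≤1 : ∀ {a b} → a ≤ 1 → b ≤ 1 → (0 < a → 0 < b → ⊥) → a + b ≤ 1
+-≤1 {zero}               _  b≤1 _    = b≤1
+-≤1 {suc zero} {zero}    _  _   _    = ≤-refl
+-≤1 {suc zero} {suc _}   _  _   both = ⊥-elim (both (s≤s z≤n) (s≤s z≤n))
+-≤1 {suc (suc _)} (s≤s ())

∑-≤1 : ∀ {n} (f : Fin n → ℕ) → (∀ i → f i ≤ 1) → (∀ i j → 0 < f i → 0 < f j → i ≡ j) →
       ∑[ i < n ] f i ≤ 1
∑-≤1 {zero}  f f≤1 unique = z≤n
∑-≤1 {suc n} f f≤1 unique =
  +-≤1 (f≤1 zero)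
       (∑-≤1 (f ∘ suc) (f≤1 ∘ suc) λ i j p q → Finₚ.suc-injective (unique _ _ p q))
       λ p q → let i , r = ∑-positive (f ∘ suc) q in Finₚ.0≢1+n (unique zero (suc i) p r)

∑-const-1 : ∀ k → ∑[ i < k ] 1 ≡ k
∑-const-1 zero    = refl
∑-const-1 (suc k) = cong suc (∑-const-1 k)

δ : ∀ {n} → Fin n → Fin n → ℕ
δ u v = ind (does (u ≟ v))

δ-positive : ∀ {n} {u v : Fin n} → 0 < δ u v → u ≡ v
δ-positive {u = u} {v} 0<δ with u ≟ v
... | yes u≡v = u≡v

δ-refl : ∀ {n} (v : Fin n) → δ v v ≡ 1
δ-refl v with v ≟ v
... | yes _   = refl
... | no  v≢v = ⊥-elim (v≢v refl)

∑-δ : ∀ {n} (w : Fin n) (h : Fin n → ℕ) → ∑[ v < n ] (δ w v * h v) ≡ h w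
∑-δ {suc n} zero h = begin
  1 * h zero + ∑[ v < n ] 0 ≡⟨ cong₂ _+_ (*-identityˡ _) (sum-replicate-zero n) ⟩
  h zero + 0                ≡⟨ +-identityʳ _ ⟩
  h zero                    ∎
  where open ≡-Reasoning
∑-δ {suc n} (suc w) h = ∑-δ w (λ v → h (suc v))

all⊎any : ∀ {m} {P Q : Fin m → Set} → (∀ p → P p ⊎ Q p) → (∀ p → P p) ⊎ ∃ Q
all⊎any {zero}  P⊎Q = inj₁ λ ()
all⊎any {suc m} P⊎Q with P⊎Q zero | all⊎any (P⊎Q ∘ suc)
... | inj₂ Q₀ | _             = inj₂ (zero , Q₀)
... | inj₁ _  | inj₂ (p , Qp) = inj₂ (suc p , Qp)
... | inj₁ P₀ | inj₁ Pₛ       = inj₁ λ { zero → P₀ ; (suc p) → Pₛ p }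

module _ {A : Set} where

  sum-map-mono-≤ : ∀ (xs : List A) {f g : A → ℕ} → (∀ x → f x ≤ g x) →
                   sum (map f xs) ≤ sum (map g xs)
  sum-map-mono-≤ []       f≤g = z≤n
  sum-map-mono-≤ (x ∷ xs) f≤g = +-mono-≤ (f≤g x) (sum-map-mono-≤ xs f≤g)

  sum-map-+ : ∀ (xs : List A) (f g : A → ℕ) →
              sum (map (λ x → f x + g x) xs) ≡ sum (map f xs) + sum (map g xs)
  sum-map-+ []       f g = refl
  sum-map-+ (x ∷ xs) f g =
    trans (cong (f x + g x +_) (sum-map-+ xs f g)) (+-interchange (f x) (g x) _ _)

  sum-map-*ˡ : ∀ (xs : List A) k (f : A → ℕ) → sum (map (λ x → k * f x) xs) ≡ k * sum (map f xs)
  sum-map-*ˡ []       k f = sym (*-zeroʳ k)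
  sum-map-*ˡ (x ∷ xs) k f =
    trans (cong (k * f x +_) (sum-map-*ˡ xs k f)) (sym (*-distribˡ-+ k (f x) _))

  sum-map-*ʳ : ∀ (xs : List A) k (f : A → ℕ) → sum (map (λ x → f x * k) xs) ≡ sum (map f xs) * k
  sum-map-*ʳ []       k f = refl
  sum-map-*ʳ (x ∷ xs) k f =
    trans (cong (f x * k +_) (sum-map-*ʳ xs k f)) (sym (*-distribʳ-+ k (f x) _))

  sum-map-∑ : ∀ (xs : List A) {n} (f : A → Fin n → ℕ) →
              sum (map (λ x → ∑[ i < n ] f x i) xs) ≡ ∑[ i < n ] sum (map (λ x → f x i) xs)
  sum-map-∑ []       {n} f = sym (sum-replicate-zero n)
  sum-map-∑ (x ∷ xs)     f =
    trans (cong (∑[ i < _ ] f x i +_) (sum-map-∑ xs f)) (sym (∑-distrib-+ (f x) _))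

  sum-map-positive : ∀ (xs : List A) (f : A → ℕ) → 0 < sum (map f xs) → ∃ λ x → 0 < f x
  sum-map-positive (x ∷ xs) f 0<∑ with f x in eq
  ... | suc _ = x , subst (0 <_) (sym eq) (s≤s z≤n)
  ... | zero  = sum-map-positive xs f 0<∑

  length-filter-T? : ∀ (b : A → Bool) (xs : List A) →
                     length (filter (λ x → T? (b x)) xs) ≡ sum (map (λ x → ind (b x)) xs)
  length-filter-T? b []       = refl
  length-filter-T? b (x ∷ xs) with b x
  ... | true  = cong suc (length-filter-T? b xs)
  ... | false = length-filter-T? b xs

∈-allSubsets : ∀ {n} (S : Subset n) → S ∈ allSubsets n
∈-allSubsets []                  = Any.here refl
∈-allSubsets {suc n} (true  ∷ S) = ∈-++⁺ˡ (∈-map⁺ (true ∷_) (∈-allSubsets S))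
∈-allSubsets {suc n} (false ∷ S) =
  ∈-++⁺ʳ (map (true ∷_) (allSubsets n)) (∈-map⁺ (false ∷_) (∈-allSubsets S))

all-allSubsets : ∀ {n} (p : Subset n → Bool) → T (all p (allSubsets n)) → ∀ S → T (p S)
all-allSubsets p all-p S = All.lookup (all⁺ p _ all-p) (∈-allSubsets S)

sum-allSubsets-suc : ∀ n (f : Subset (suc n) → ℕ) →
  sum (map f (allSubsets (suc n))) ≡
  sum (map (f ∘ (true ∷_)) (allSubsets n)) + sum (map (f ∘ (false ∷_)) (allSubsets n))
sum-allSubsets-suc n f = begin
  sum (map f (map (true ∷_) 𝒮 ++ map (false ∷_) 𝒮))
    ≡⟨ cong sum (map-++ f (map (true ∷_) 𝒮) _) ⟩
  sum (map f (map (true ∷_) 𝒮) ++ map f (map (false ∷_) 𝒮))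
    ≡⟨ sum-++ (map f (map (true ∷_) 𝒮)) _ ⟩
  sum (map f (map (true ∷_) 𝒮)) + sum (map f (map (false ∷_) 𝒮))
    ≡⟨ sym (cong₂ _+_ (cong sum (map-∘ 𝒮)) (cong sum (map-∘ 𝒮))) ⟩
  sum (map (f ∘ (true ∷_)) 𝒮) + sum (map (f ∘ (false ∷_)) 𝒮) ∎
  where
  open ≡-Reasoning
  𝒮 : List (Subset n)
  𝒮 = allSubsets n

sum-allSubsets-≤1 : ∀ n (f : Subset n → ℕ) → (∀ S → f S ≤ 1) →
                    (∀ S S′ → 0 < f S → 0 < f S′ → S ≡ S′) → sum (map f (allSubsets n)) ≤ 1
sum-allSubsets-≤1 zero    f f≤1 unique = ≤-trans (≤-reflexive (+-identityʳ _)) (f≤1 [])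
sum-allSubsets-≤1 (suc n) f f≤1 unique rewrite sum-allSubsets-suc n f =
  +-≤1 (sum-allSubsets-≤1 n _ (f≤1 ∘ (true ∷_))  λ S S′ p q → ∷-injectiveʳ (unique _ _ p q))
       (sum-allSubsets-≤1 n _ (f≤1 ∘ (false ∷_)) λ S S′ p q → ∷-injectiveʳ (unique _ _ p q))
       λ p q → true≢false (∷-injectiveˡ (unique _ _ (proj₂ (sum-map-positive 𝒮 (f ∘ (true ∷_)) p))
                                                   (proj₂ (sum-map-positive 𝒮 (f ∘ (false ∷_)) q))))
  where
  𝒮 : List (Subset n)
  𝒮 = allSubsets n

∈⇒T-lookup : ∀ {n} {S : Subset n} {v} → v ∈ₛ S → T (lookup S v)
∈⇒T-lookup v∈S = Equivalence.from T-≡ ([]=⇒lookup v∈S)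

T-lookup⇒∈ : ∀ {n} (S : Subset n) v → T (lookup S v) → v ∈ₛ S
T-lookup⇒∈ S v Sv = lookup⇒[]= v S (Equivalence.to T-≡ Sv)

∉⇒lookup≡false : ∀ {n} (S : Subset n) {v} → v ∉ₛ S → lookup S v ≡ false
∉⇒lookup≡false S {v} v∉S with lookup S v in Sv
... | false = refl
... | true  = ⊥-elim (v∉S (lookup⇒[]= v S Sv))

∣S∣≡∑ : ∀ {n} (S : Subset n) → ∣ S ∣ ≡ ∑[ v < n ] ind (lookup S v)
∣S∣≡∑ []          = refl
∣S∣≡∑ (true  ∷ S) = cong suc (∣S∣≡∑ S)
∣S∣≡∑ (false ∷ S) = ∣S∣≡∑ S

x∈p─q⇒x∉q : ∀ {n} {p q : Subset n} {x} → x ∈ₛ p ─ q → x ∉ₛ q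
x∈p─q⇒x∉q {p = _ ∷ _} {outside ∷ _} here        ()
x∈p─q⇒x∉q {p = _ ∷ _} {_       ∷ _} (there x∈) (there x∈q) = x∈p─q⇒x∉q x∈ x∈q

singleton-member : ∀ {n} {C : Subset n} {v w} → ∣ C ∣ ≡ 1 → v ∈ₛ C → w ∈ₛ C → w ≡ v
singleton-member {C = C} {v} {w} ∣C∣≡1 v∈C w∈C with w ≟ v
... | yes w≡v = w≡v
... | no  w≢v = ⊥-elim (<-irrefl (sym ∣C∣≡1) (subst (_< ∣ C ∣) (∣⁅x⁆∣≡1 v) ⁅v⁆<C))
  where
  ⁅v⁆<C : ∣ ⁅ v ⁆ ∣ < ∣ C ∣
  ⁅v⁆<C = p⊂q⇒∣p∣<∣q∣
    ((λ u∈⁅v⁆ → subst (_∈ₛ C) (sym (x∈⁅y⁆⇒x≡y v u∈⁅v⁆)) v∈C) , w , w∈C , x≢y⇒x∉⁅y⁆ w≢v)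

module _ {n : ℕ} where

  any-allFin⁺ : (p : Fin n → Bool) → ∀ v → T (p v) → T (any p (allFin n))
  any-allFin⁺ p v pv = any⁺ p (Any.map (λ { refl → pv }) (∈-allFin v))

  any-allFin⁻ : (p : Fin n → Bool) → T (any p (allFin n)) → ∃ λ v → T (p v)
  any-allFin⁻ p h = Any.satisfied (any⁻ p (allFin n) h)

  all-allFin⁺ : (p : Fin n → Bool) → (∀ v → T (p v)) → T (all p (allFin n))
  all-allFin⁺ p h = all⁻ p {allFin n} (All.tabulate λ {v} _ → h v)

  all-allFin⁻ : (p : Fin n → Bool) → T (all p (allFin n)) → ∀ v → T (p v)
  all-allFin⁻ p h v = All.lookup (all⁺ p (allFin n) h) (∈-allFin v)

-- Charges along a factor path

adjacentᵇ : ∀ {k} → Fin k → Fin k → Bool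
adjacentᵇ i j = (suc (toℕ i) ≡ᵇ toℕ j) ∨ (suc (toℕ j) ≡ᵇ toℕ i)

adjacentᵇ-irrefl : ∀ {k} (i : Fin k) → ¬ T (adjacentᵇ i i)
adjacentᵇ-irrefl i adj-ii =
  1+n≢n (≡ᵇ⇒≡ (suc (toℕ i)) (toℕ i) (reduce (Equivalence.to (T-∨ {suc (toℕ i) ≡ᵇ toℕ i}) adj-ii)))

adjacentᵇ⇒adj : ∀ {n k} {G : Graph n} (P : PathIn G k) {i j} → T (adjacentᵇ i j) →
                adj G (vert P i) (vert P j) ≡ true
adjacentᵇ⇒adj {G = G} P {i} {j} adj-ij with Equivalence.to (T-∨ {suc (toℕ i) ≡ᵇ toℕ j}) adj-ij
... | inj₁ h = consecutive P i j (sym (≡ᵇ⇒≡ (suc (toℕ i)) (toℕ j) h))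
... | inj₂ h = trans (adj-sym G _ _) (consecutive P j i (sym (≡ᵇ⇒≡ (suc (toℕ j)) (toℕ i) h)))

degree : ∀ {k} → Fin k → ℕ
degree {k} i = ∑[ j < k ] ind (adjacentᵇ i j)

weight : ∀ {k} → Fin k → ℕ
weight i = if degree i ≡ᵇ 1 then 2 else 1

xNeighbours : ∀ {k} → Vec Bool k → Fin k → ℕ
xNeighbours {k} x i = ∑[ j < k ] ind (adjacentᵇ i j ∧ lookup x j)

-- x marks the vertices of a factor path that lie in X.
charge : ∀ {k} → Vec Bool k → Fin k → ℕ
charge x i = if lookup x i then 0 else weight i * xNeighbours x i

charge-boundᵇ : ∀ k → Vec Bool k → Bool
charge-boundᵇ k x = ∑[ i < k ] charge x i ≤ᵇ 3 * ∑[ i < k ] ind (lookup x i)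

-- Checked by evaluation on all 2ᵏ patterns.  This is where P₃ is excluded: the
-- centre of a P₃ lying in X would pay 2 to each endpoint.
charge-bound : ∀ {k} → k ≡ 2 ⊎ k ≡ 5 → (x : Vec Bool k) →
               ∑[ i < k ] charge x i ≤ 3 * ∑[ i < k ] ind (lookup x i)
charge-bound (inj₁ refl) x = ≤ᵇ⇒≤ _ _ (all-allSubsets (charge-boundᵇ 2) _ x)
charge-bound (inj₂ refl) x = ≤ᵇ⇒≤ _ _ (all-allSubsets (charge-boundᵇ 5) _ x)

weight*degree≡2 : ∀ {k} → k ≡ 2 ⊎ k ≡ 5 → (i : Fin k) → weight i * degree i ≡ 2
weight*degree≡2 (inj₁ refl) 0F = refl
weight*degree≡2 (inj₁ refl) 1F = refl
weight*degree≡2 (inj₂ refl) 0F = refl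
weight*degree≡2 (inj₂ refl) 1F = refl
weight*degree≡2 (inj₂ refl) 2F = refl
weight*degree≡2 (inj₂ refl) 3F = refl
weight*degree≡2 (inj₂ refl) 4F = refl

charge-isolated : ∀ {k} → k ≡ 2 ⊎ k ≡ 5 → (x : Vec Bool k) (i : Fin k) → lookup x i ≡ false →
                  (∀ j → T (adjacentᵇ i j) → lookup x j ≡ true) → charge x i ≡ 2
charge-isolated k∈25 x i xᵢ≡false neighbours∈X rewrite xᵢ≡false =
  trans (cong (weight i *_) (sum-cong-≗ all-in-X)) (weight*degree≡2 k∈25 i)
  where
  all-in-X : ∀ j → ind (adjacentᵇ i j ∧ lookup x j) ≡ ind (adjacentᵇ i j)
  all-in-X j with adjacentᵇ i j in adj-ij
  ... | false = refl
  ... | true  rewrite neighbours∈X j (subst T (sym adj-ij) _) = refl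

1≤weight : ∀ {k} (i : Fin k) → 1 ≤ weight i
1≤weight i with degree i ≡ᵇ 1
... | true  = s≤s z≤n
... | false = s≤s z≤n

charge-positive : ∀ {k} (x : Vec Bool k) {i j : Fin k} → T (adjacentᵇ i j) →
                  lookup x i ≡ false → lookup x j ≡ true → 1 ≤ charge x i
charge-positive x {i} {j} adj-ij xᵢ≡false xⱼ≡true rewrite xᵢ≡false =
  *-mono-≤ (1≤weight i) (≤-trans 1≤term (f≤∑f _ j))
  where
  1≤term : 1 ≤ ind (adjacentᵇ i j ∧ lookup x j)
  1≤term rewrite xⱼ≡true | Equivalence.to T-≡ adj-ij = ≤-refl

constant-from-head : ∀ {k} (f : Fin (suc (suc k)) → Bool) → (∀ i j → f (suc i) ≡ f (suc j)) →
                     f 1F ≡ f 0F → ∀ i j → f i ≡ f j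
constant-from-head f tail-constant f₁≡f₀ i j = trans (≡head i) (sym (≡head j))
  where
  ≡head : ∀ i → f i ≡ f 0F
  ≡head zero    = refl
  ≡head (suc i) = trans (tail-constant i 0F) f₁≡f₀

constant-or-switch : ∀ {k} (f : Fin k → Bool) →
  (∀ i j → f i ≡ f j) ⊎ ∃₂ λ i j → T (adjacentᵇ i j) × f i ≡ true × f j ≡ false
constant-or-switch {zero}        f = inj₁ λ ()
constant-or-switch {suc zero}    f = inj₁ λ { zero zero → refl }
constant-or-switch {suc (suc k)} f with constant-or-switch (f ∘ suc)
... | inj₂ (i , j , adj-ij , fᵢ , fⱼ) = inj₂ (suc i , suc j , adj-ij , fᵢ , fⱼ)
... | inj₁ tail-constant with f 0F in f₀ | f 1F in f₁
... | true  | false = inj₂ (0F , 1F , _ , f₀ , f₁)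
... | false | true  = inj₂ (1F , 0F , _ , f₁ , f₀)
... | true  | true  = inj₁ (constant-from-head f tail-constant (trans f₁ (sym f₀)))
... | false | false = inj₁ (constant-from-head f tail-constant (trans f₁ (sym f₀)))

∑-ind-constant : ∀ {k} (f : Fin k → Bool) → (∀ i j → f i ≡ f j) →
                 ∑[ i < k ] ind (f i) ≡ 0 ⊎ ∑[ i < k ] ind (f i) ≡ k
∑-ind-constant {zero}  f constant = inj₁ refl
∑-ind-constant {suc k} f constant
  rewrite sum-cong-≗ {suc k} (λ i → cong ind (constant i 0F)) = ∑-ind-replicate (f 0F)
  where
  ∑-ind-replicate : ∀ b → ∑[ i < suc k ] ind b ≡ 0 ⊎ ∑[ i < suc k ] ind b ≡ suc k
  ∑-ind-replicate true  = inj₂ (∑-const-1 (suc k))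
  ∑-ind-replicate false = inj₁ (sum-replicate-zero (suc k))

∑-of-0-2-5≢1,3 : ∀ {m} (t : Fin m → ℕ) → (∀ p → t p ≡ 0 ⊎ t p ≡ 2 ⊎ t p ≡ 5) →
                 ∑[ p < m ] t p ≢ 1 × ∑[ p < m ] t p ≢ 3
∑-of-0-2-5≢1,3 {zero}  t t∈025 = (λ ()) , (λ ())
∑-of-0-2-5≢1,3 {suc m} t t∈025 with t∈025 0F | ∑-of-0-2-5≢1,3 (t ∘ suc) (t∈025 ∘ suc)
... | inj₁ t₀≡0        | ≢1 , ≢3 rewrite t₀≡0 = ≢1 , ≢3
... | inj₂ (inj₁ t₀≡2) | ≢1 , _  rewrite t₀≡2 =
  (λ ()) , λ 2+r≡3 → ≢1 (suc-injective (suc-injective 2+r≡3))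
... | inj₂ (inj₂ t₀≡5) | _       rewrite t₀≡5 = (λ ()) , (λ ())

-- Components of G − X

module _ {n : ℕ} (G : Graph n) where

  nonemptyᵇ⁺ : ∀ {S} → Nonempty S → T (nonemptyᵇ G S)
  nonemptyᵇ⁺ (v , v∈S) = any-allFin⁺ _ v (∈⇒T-lookup v∈S)

  nonemptyᵇ⁻ : ∀ {S} → T (nonemptyᵇ G S) → Nonempty S
  nonemptyᵇ⁻ {S} h = let v , Sv = any-allFin⁻ _ h in v , T-lookup⇒∈ S v Sv

  ⊆ᵇ⁺ : ∀ {S S′} → S ⊆ₛ S′ → T (_⊆ᵇ_ G S S′)
  ⊆ᵇ⁺ {S} {S′} S⊆S′ = all-allFin⁺ _ member
    where
    member : ∀ v → T (not (lookup S v) ∨ lookup S′ v)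
    member v with lookup S v in Sv
    ... | true  = ∈⇒T-lookup (S⊆S′ (lookup⇒[]= v S Sv))
    ... | false = _

  ⊆ᵇ⁻ : ∀ {S S′} → T (_⊆ᵇ_ G S S′) → S ⊆ₛ S′
  ⊆ᵇ⁻ {S} {S′} h {v} v∈S with Equivalence.to T-∨ (all-allFin⁻ _ h v)
  ... | inj₁ v∉S  = ⊥-elim (T-not⇒¬T v∉S (∈⇒T-lookup v∈S))
  ... | inj₂ v∈S′ = T-lookup⇒∈ S′ v v∈S′

  edgeBetween⁺ : ∀ {S S′ u w} → u ∈ₛ S → w ∈ₛ S′ → adj G u w ≡ true → T (edgeBetween G S S′)
  edgeBetween⁺ {u = u} {w} u∈S w∈S′ uw =
    any-allFin⁺ _ u (any-allFin⁺ _ w (Equivalence.from T-∧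
      (∈⇒T-lookup u∈S , Equivalence.from T-∧ (∈⇒T-lookup w∈S′ , Equivalence.from T-≡ uw))))

  edgeBetween⁻ : ∀ {S S′} → T (edgeBetween G S S′) →
                 ∃₂ λ u w → u ∈ₛ S × w ∈ₛ S′ × adj G u w ≡ true
  edgeBetween⁻ {S} {S′} h with any-allFin⁻ _ h
  ... | u , h′ with any-allFin⁻ _ h′
  ... | w , h″ with Equivalence.to T-∧ h″
  ... | Su , h‴ with Equivalence.to T-∧ h‴
  ... | S′w , uw = u , w , T-lookup⇒∈ S u Su , T-lookup⇒∈ S′ w S′w , Equivalence.to T-≡ uw

  connectedᵇ⁻ : ∀ {C} → T (connectedᵇ G C) → ∀ S →
                T (not (_⊆ᵇ_ G S C ∧ nonemptyᵇ G S ∧ not (_≡ˢ_ G S C)) ∨ edgeBetween G S (C ─ S))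
  connectedᵇ⁻ {C} = all-allSubsets
    (λ S → not (_⊆ᵇ_ G S C ∧ nonemptyᵇ G S ∧ not (_≡ˢ_ G S C)) ∨ edgeBetween G S (C ─ S))

  connectivity-case : ∀ {a b c e} → T (not (a ∧ b ∧ not c) ∨ e) → T a → T b → T c ⊎ T e
  connectivity-case {true} {true} {true}  _ _ _ = inj₁ _
  connectivity-case {true} {true} {false} h _ _ = inj₂ h

  module _ (X : Subset n) where

    isComponentᵇ⁻ : ∀ {C} → T (isComponentᵇ G X C) →
                    T (nonemptyᵇ G C) × T (not (nonemptyᵇ G (C ∩ X))) × T (connectedᵇ G C) ×
                    T (not (edgeBetween G C (∁ (C ∪ X))))
    isComponentᵇ⁻ {C} h =
      let ne , h₁   = to (T-∧ {nonemptyᵇ G C}) h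
          no-X , h₂ = to (T-∧ {not (nonemptyᵇ G (C ∩ X))}) h₁
          conn , no-out = to (T-∧ {connectedᵇ G C}) h₂
      in  ne , no-X , conn , no-out
      where open Equivalence

    record Component (C : Subset n) : Set where
      field
        nonempty  : Nonempty C
        avoids-X  : ∀ {v} → v ∈ₛ C → v ∉ₛ X
        closed    : ∀ {u w} → u ∈ₛ C → adj G u w ≡ true → w ∈ₛ C ⊎ w ∈ₛ X
        connected : ∀ {S} → S ⊆ₛ C → Nonempty S →
                    C ⊆ₛ S ⊎ ∃₂ λ u w → u ∈ₛ S × w ∈ₛ C × w ∉ₛ S × adj G u w ≡ true

    isComponentᵇ⇒Component : ∀ C → T (isComponentᵇ G X C) → Component C
    isComponentᵇ⇒Component C h with isComponentᵇ⁻ {C} h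
    ... | ne , no-X , conn , no-out = record
      { nonempty  = nonemptyᵇ⁻ {C} ne
      ; avoids-X  = λ v∈C v∈X → T-not⇒¬T no-X (nonemptyᵇ⁺ {C ∩ X} (_ , x∈p∩q⁺ (v∈C , v∈X)))
      ; closed    = closed
      ; connected = connected
      }
      where
      open Equivalence

      closed : ∀ {u w} → u ∈ₛ C → adj G u w ≡ true → w ∈ₛ C ⊎ w ∈ₛ X
      closed {w = w} u∈C uw with w ∈? C | w ∈? X
      ... | yes w∈C | _       = inj₁ w∈C
      ... | no  _   | yes w∈X = inj₂ w∈X
      ... | no  w∉C | no  w∉X = ⊥-elim (T-not⇒¬T no-out (edgeBetween⁺ {C} {∁ (C ∪ X)} u∈C
              (x∉p⇒x∈∁p λ w∈C∪X → [ w∉C , w∉X ] (x∈p∪q⁻ C X w∈C∪X)) uw))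

      connected : ∀ {S} → S ⊆ₛ C → Nonempty S →
                  C ⊆ₛ S ⊎ ∃₂ λ u w → u ∈ₛ S × w ∈ₛ C × w ∉ₛ S × adj G u w ≡ true
      connected {S} S⊆C S≠∅
        with connectivity-case (connectedᵇ⁻ {C} conn S) (⊆ᵇ⁺ {S} {C} S⊆C) (nonemptyᵇ⁺ {S} S≠∅)
      ... | inj₁ S≡C  = inj₁ (⊆ᵇ⁻ {C} {S} (proj₂ (to (T-∧ {_⊆ᵇ_ G S C}) S≡C)))
      ... | inj₂ edge =
        let u , w , u∈S , w∈C─S , uw = edgeBetween⁻ {S} {C ─ S} edge
        in  inj₂ (u , w , u∈S , p─q⊆p C S w∈C─S , x∈p─q⇒x∉q w∈C─S , uw)

    component-unique : ∀ {C D v} → Component C → Component D → v ∈ₛ C → v ∈ₛ D → C ≡ D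
    component-unique {C} {D} {v} C-comp D-comp v∈C v∈D =
      ⊆-antisym (⊆-by-connectivity C-comp D-comp v∈C v∈D) (⊆-by-connectivity D-comp C-comp v∈D v∈C)
      where
      ⊆-by-connectivity : ∀ {C D} → Component C → Component D → v ∈ₛ C → v ∈ₛ D → C ⊆ₛ D
      ⊆-by-connectivity {C} {D} C-comp D-comp v∈C v∈D
        with Component.connected C-comp (p∩q⊆p C D) (v , x∈p∩q⁺ (v∈C , v∈D))
      ... | inj₁ C⊆C∩D = p∩q⊆q C D ∘ C⊆C∩D
      ... | inj₂ (u , w , u∈C∩D , w∈C , w∉C∩D , uw)
        with Component.closed D-comp (p∩q⊆q C D u∈C∩D) uw
      ... | inj₁ w∈D = ⊥-elim (w∉C∩D (x∈p∩q⁺ (w∈C , w∈D)))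
      ... | inj₂ w∈X = ⊥-elim (Component.avoids-X C-comp w∈C w∈X)

-- Positions in a {P₂,P₅}-factor

module _ {n : ℕ} {G : Graph n} (F : P2P5Factor G) where
  open P2P5Factor F

  Position : Set
  Position = Σ (Fin m) (Fin ∘ size)

  vertexAt : Position → Fin n
  vertexAt (p , i) = vert (path p) i

  position : Fin n → Position
  position v = proj₁ (cover v)

  vertexAt-position : ∀ v → vertexAt (position v) ≡ v
  vertexAt-position v = proj₂ (cover v)

  position-vertexAt : ∀ q → position (vertexAt q) ≡ q
  position-vertexAt (p , i) = unique _ p _ i (vertexAt-position (vertexAt (p , i)))

  multiplicity≡1 : ∀ v → ∑[ p < m ] ∑[ i < size p ] δ (vertexAt (p , i)) v ≡ 1
  multiplicity≡1 v = ≤-antisym (∑-≤1 _ on-path-≤1 one-path) 1≤multiplicity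
    where
    on-path-≤1 : ∀ p → ∑[ i < size p ] δ (vertexAt (p , i)) v ≤ 1
    on-path-≤1 p = ∑-≤1 _ (λ i → ind≤1 _)
      λ i j δᵢ δⱼ → injective (path p) (trans (δ-positive δᵢ) (sym (δ-positive δⱼ)))

    one-path : ∀ p q → 0 < ∑[ i < size p ] δ (vertexAt (p , i)) v →
                       0 < ∑[ j < size q ] δ (vertexAt (q , j)) v → p ≡ q
    one-path p q on-p on-q =
      let i , δᵢ = ∑-positive _ on-p
          j , δⱼ = ∑-positive _ on-q
      in  cong proj₁ (unique p q i j (trans (δ-positive δᵢ) (sym (δ-positive δⱼ))))

    1≤multiplicity : 1 ≤ ∑[ p < m ] ∑[ i < size p ] δ (vertexAt (p , i)) v
    1≤multiplicity = let p , i = position v in begin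
      1
        ≡⟨ sym (trans (cong (λ u → δ u v) (vertexAt-position v)) (δ-refl v)) ⟩
      δ (vertexAt (p , i)) v
        ≤⟨ f≤∑f (λ j → δ (vertexAt (p , j)) v) i ⟩
      ∑[ j < size p ] δ (vertexAt (p , j)) v
        ≤⟨ f≤∑f (λ q → ∑[ j < size q ] δ (vertexAt (q , j)) v) p ⟩
      ∑[ q < m ] ∑[ j < size q ] δ (vertexAt (q , j)) v ∎
      where open ≤-Reasoning

  ∑-by-positions : ∀ (h : Fin n → ℕ) →
                   ∑[ v < n ] h v ≡ ∑[ p < m ] ∑[ i < size p ] h (vertexAt (p , i))
  ∑-by-positions h = begin
    ∑[ v < n ] h v
      ≡⟨ sum-cong-≗ (λ v → sym (trans (cong (_* h v) (multiplicity≡1 v)) (*-identityˡ (h v)))) ⟩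
    ∑[ v < n ] ((∑[ p < m ] ∑[ i < size p ] δ (vertexAt (p , i)) v) * h v)
      ≡⟨ sum-cong-≗ {n} (λ v → *-distribʳ-sum (h v) λ p → ∑[ i < size p ] δ (vertexAt (p , i)) v) ⟩
    ∑[ v < n ] ∑[ p < m ] ((∑[ i < size p ] δ (vertexAt (p , i)) v) * h v)
      ≡⟨ sum-cong-≗ {n} (λ v → sum-cong-≗ {m} λ p →
           *-distribʳ-sum (h v) λ i → δ (vertexAt (p , i)) v) ⟩
    ∑[ v < n ] ∑[ p < m ] ∑[ i < size p ] (δ (vertexAt (p , i)) v * h v)
      ≡⟨ ∑-comm {n} {m} (λ v p → ∑[ i < size p ] (δ (vertexAt (p , i)) v * h v)) ⟩
    ∑[ p < m ] ∑[ v < n ] ∑[ i < size p ] (δ (vertexAt (p , i)) v * h v)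
      ≡⟨ sum-cong-≗ {m} (λ p → ∑-comm {n} {size p} λ v i → δ (vertexAt (p , i)) v * h v) ⟩
    ∑[ p < m ] ∑[ i < size p ] ∑[ v < n ] (δ (vertexAt (p , i)) v * h v)
      ≡⟨ sum-cong-≗ (λ p → sum-cong-≗ λ i → ∑-δ (vertexAt (p , i)) h) ⟩
    ∑[ p < m ] ∑[ i < size p ] h (vertexAt (p , i)) ∎
    where open ≡-Reasoning

  leaving-factor-edge : ∀ C → ∣ C ∣ ≡ 3 →
    ∃ λ p → ∃₂ λ i j → T (adjacentᵇ i j) × lookup C (vertexAt (p , i)) ≡ true ×
                                          lookup C (vertexAt (p , j)) ≡ false
  leaving-factor-edge C ∣C∣≡3
    with all⊎any (λ p → constant-or-switch (λ i → lookup C (vertexAt (p , i))))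
  ... | inj₂ edge         = edge
  ... | inj₁ all-constant = ⊥-elim (proj₂ (∑-of-0-2-5≢1,3 _ counts) (trans (sym ∣C∣≡∑) ∣C∣≡3))
    where
    ∣C∣≡∑ : ∣ C ∣ ≡ ∑[ p < m ] ∑[ i < size p ] ind (lookup C (vertexAt (p , i)))
    ∣C∣≡∑ = trans (∣S∣≡∑ C) (∑-by-positions (ind ∘ lookup C))

    0-or-size : ∀ {t k} → t ≡ 0 ⊎ t ≡ k → k ≡ 2 ⊎ k ≡ 5 → t ≡ 0 ⊎ t ≡ 2 ⊎ t ≡ 5
    0-or-size (inj₁ t≡0) _          = inj₁ t≡0
    0-or-size (inj₂ t≡k) (inj₁ k≡2) = inj₂ (inj₁ (trans t≡k k≡2))
    0-or-size (inj₂ t≡k) (inj₂ k≡5) = inj₂ (inj₂ (trans t≡k k≡5))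

    counts : ∀ p → let t = ∑[ i < size p ] ind (lookup C (vertexAt (p , i))) in
                   t ≡ 0 ⊎ t ≡ 2 ⊎ t ≡ 5
    counts p = 0-or-size (∑-ind-constant _ (all-constant p)) (size25 p)

-- Discharging

demand-bound : ∀ b s {c} → (T b → s ≡ 1 → 2 ≤ c) → (T b → s ≡ 3 → 1 ≤ c) →
               2 * ind (b ∧ (s ≡ᵇ 1)) + ind (b ∧ (s ≡ᵇ 3)) ≤ c
demand-bound false _                         _         _           = z≤n
demand-bound true  0                         _         _           = z≤n
demand-bound true  1                         singleton _           = singleton _ refl
demand-bound true  2                         _         _           = z≤n
demand-bound true  3                         _         triple      = triple _ refl
demand-bound true  (suc (suc (suc (suc _)))) _         _           = z≤n

module _ {n : ℕ} {G : Graph n} (F : P2P5Factor G) (X : Subset n) where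
  open P2P5Factor F

  inX : (p : Fin m) → Vec Bool (size p)
  inX p = tabulate λ i → lookup X (vertexAt F (p , i))

  inX-lookup : ∀ p i → lookup (inX p) i ≡ lookup X (vertexAt F (p , i))
  inX-lookup p i = lookup∘tabulate (λ j → lookup X (vertexAt F (p , j))) i

  vertexCharge : Fin n → ℕ
  vertexCharge v = let p , i = position F v in charge (inX p) i

  vertexCharge-vertexAt : ∀ p i → vertexCharge (vertexAt F (p , i)) ≡ charge (inX p) i
  vertexCharge-vertexAt p i rewrite position-vertexAt F (p , i) = refl

  total-charge≤3∣X∣ : ∑[ v < n ] vertexCharge v ≤ 3 * ∣ X ∣
  total-charge≤3∣X∣ = begin
    ∑[ v < n ] vertexCharge v
      ≡⟨ ∑-by-positions F vertexCharge ⟩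
    ∑[ p < m ] ∑[ i < size p ] vertexCharge (vertexAt F (p , i))
      ≡⟨ sum-cong-≗ {m} (λ p → sum-cong-≗ (vertexCharge-vertexAt p)) ⟩
    ∑[ p < m ] ∑[ i < size p ] charge (inX p) i
      ≤⟨ ∑-mono-≤ (λ p → charge-bound (size25 p) (inX p)) ⟩
    ∑[ p < m ] (3 * ∑[ i < size p ] ind (lookup (inX p) i))
      ≡⟨ sym (*-distribˡ-sum 3 λ p → ∑[ i < size p ] ind (lookup (inX p) i)) ⟩
    3 * ∑[ p < m ] ∑[ i < size p ] ind (lookup (inX p) i)
      ≡⟨ cong (3 *_) (sum-cong-≗ {m} λ p → sum-cong-≗ {size p} λ i → cong ind (inX-lookup p i)) ⟩
    3 * ∑[ p < m ] ∑[ i < size p ] ind (lookup X (vertexAt F (p , i)))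
      ≡⟨ cong (3 *_) (sym (trans (∣S∣≡∑ X) (∑-by-positions F (ind ∘ lookup X)))) ⟩
    3 * ∣ X ∣ ∎
    where open ≤-Reasoning

  componentCharge : Subset n → ℕ
  componentCharge C = ∑[ v < n ] (ind (isComponentᵇ G X C ∧ lookup C v) * vertexCharge v)

  member-charge≤componentCharge : ∀ {C v} → T (isComponentᵇ G X C) → v ∈ₛ C →
                                  vertexCharge v ≤ componentCharge C
  member-charge≤componentCharge {C} {v} C-comp v∈C = begin
    vertexCharge v
      ≡⟨ sym (*-identityˡ _) ⟩
    1 * vertexCharge v
      ≡⟨ cong (_* vertexCharge v) (sym (ind-T both)) ⟩
    ind (isComponentᵇ G X C ∧ lookup C v) * vertexCharge v
      ≤⟨ f≤∑f (λ u → ind (isComponentᵇ G X C ∧ lookup C u) * vertexCharge u) v ⟩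
    componentCharge C ∎
    where
    open ≤-Reasoning
    both : T (isComponentᵇ G X C ∧ lookup C v)
    both = Equivalence.from T-∧ (C-comp , ∈⇒T-lookup v∈C)

  position-charge≤componentCharge : ∀ {C} p i → T (isComponentᵇ G X C) → vertexAt F (p , i) ∈ₛ C →
                                    charge (inX p) i ≤ componentCharge C
  position-charge≤componentCharge p i C-comp vᵢ∈C =
    subst (_≤ _) (vertexCharge-vertexAt p i) (member-charge≤componentCharge C-comp vᵢ∈C)

  singleton-charge : ∀ C → T (isComponentᵇ G X C) → ∣ C ∣ ≡ 1 → 2 ≤ componentCharge C
  singleton-charge C C-comp ∣C∣≡1 =
    ≤-trans 2≤chargeᵢ (position-charge≤componentCharge {C} p i C-comp vᵢ∈C)
    where
    open Component (isComponentᵇ⇒Component G X C C-comp)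
    v : Fin n
    v = proj₁ nonempty
    p : Fin m
    p = proj₁ (position F v)
    i : Fin (size p)
    i = proj₂ (position F v)

    vᵢ∈C : vertexAt F (p , i) ∈ₛ C
    vᵢ∈C = subst (_∈ₛ C) (sym (vertexAt-position F v)) (proj₂ nonempty)

    neighbours-in-X : ∀ j → T (adjacentᵇ i j) → lookup (inX p) j ≡ true
    neighbours-in-X j adj-ij with closed vᵢ∈C (adjacentᵇ⇒adj (path p) adj-ij)
    ... | inj₂ vⱼ∈X = trans (inX-lookup p j) ([]=⇒lookup vⱼ∈X)
    ... | inj₁ vⱼ∈C = ⊥-elim (adjacentᵇ-irrefl i (subst (T ∘ adjacentᵇ i) j≡i adj-ij))
      where
      j≡i : j ≡ i
      j≡i = injective (path p) (singleton-member ∣C∣≡1 vᵢ∈C vⱼ∈C)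

    2≤chargeᵢ : 2 ≤ charge (inX p) i
    2≤chargeᵢ = ≤-reflexive (sym (charge-isolated (size25 p) (inX p) i
      (trans (inX-lookup p i) (∉⇒lookup≡false X (avoids-X vᵢ∈C))) neighbours-in-X))

  triple-charge : ∀ C → T (isComponentᵇ G X C) → ∣ C ∣ ≡ 3 → 1 ≤ componentCharge C
  triple-charge C C-comp ∣C∣≡3 with leaving-factor-edge F C ∣C∣≡3
  ... | p , i , j , adj-ij , Cᵢ , Cⱼ =
    ≤-trans (charge-positive (inX p) adj-ij xᵢ≡false xⱼ≡true)
            (position-charge≤componentCharge {C} p i C-comp vᵢ∈C)
    where
    open Component (isComponentᵇ⇒Component G X C C-comp)
    vᵢ∈C : vertexAt F (p , i) ∈ₛ C
    vᵢ∈C = lookup⇒[]= _ C Cᵢ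

    xᵢ≡false : lookup (inX p) i ≡ false
    xᵢ≡false = trans (inX-lookup p i) (∉⇒lookup≡false X (avoids-X vᵢ∈C))

    xⱼ≡true : lookup (inX p) j ≡ true
    xⱼ≡true with closed vᵢ∈C (adjacentᵇ⇒adj (path p) adj-ij)
    ... | inj₁ vⱼ∈C = ⊥-elim (true≢false (trans (sym ([]=⇒lookup vⱼ∈C)) Cⱼ))
    ... | inj₂ vⱼ∈X = trans (inX-lookup p j) ([]=⇒lookup vⱼ∈X)

  demand : Subset n → ℕ
  demand C = 2 * ind (isComponentᵇ G X C ∧ (∣ C ∣ ≡ᵇ 1)) + ind (isComponentᵇ G X C ∧ (∣ C ∣ ≡ᵇ 3))

  demand≤componentCharge : ∀ C → demand C ≤ componentCharge C
  demand≤componentCharge C =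
    demand-bound (isComponentᵇ G X C) ∣ C ∣ (singleton-charge C) (triple-charge C)

  components-charge≤total : sum (map componentCharge (allSubsets n)) ≤ ∑[ v < n ] vertexCharge v
  components-charge≤total = begin
    sum (map componentCharge 𝒮)
      ≡⟨ sum-map-∑ 𝒮 (λ C v → ind (isComponentᵇ G X C ∧ lookup C v) * vertexCharge v) ⟩
    ∑[ v < n ] sum (map (λ C → ind (isComponentᵇ G X C ∧ lookup C v) * vertexCharge v) 𝒮)
      ≡⟨ sum-cong-≗ {n} (λ v →
           sum-map-*ʳ 𝒮 (vertexCharge v) λ C → ind (isComponentᵇ G X C ∧ lookup C v)) ⟩
    ∑[ v < n ] (sum (map (λ C → ind (isComponentᵇ G X C ∧ lookup C v)) 𝒮) * vertexCharge v)
      ≤⟨ ∑-mono-≤ (λ v → *-monoˡ-≤ (vertexCharge v) (in-one-component v)) ⟩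
    ∑[ v < n ] (1 * vertexCharge v)
      ≡⟨ sum-cong-≗ {n} (λ v → *-identityˡ (vertexCharge v)) ⟩
    ∑[ v < n ] vertexCharge v ∎
    where
    open ≤-Reasoning
    𝒮 : List (Subset n)
    𝒮 = allSubsets n

    in-one-component : ∀ v → sum (map (λ C → ind (isComponentᵇ G X C ∧ lookup C v)) 𝒮) ≤ 1
    in-one-component v = sum-allSubsets-≤1 n _ (λ C → ind≤1 _) λ C D v∈C v∈D →
      let C-comp , Cv = Equivalence.to (T-∧ {isComponentᵇ G X C}) (ind-positive v∈C)
          D-comp , Dv = Equivalence.to (T-∧ {isComponentᵇ G X D}) (ind-positive v∈D)
      in  component-unique G X (isComponentᵇ⇒Component G X C C-comp)
                               (isComponentᵇ⇒Component G X D D-comp)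
                               (T-lookup⇒∈ C v Cv) (T-lookup⇒∈ D v Dv)

  2c₁+c₃≡∑demand : 2 * c G 1 X + c G 3 X ≡ sum (map demand (allSubsets n))
  2c₁+c₃≡∑demand = begin
    2 * c G 1 X + c G 3 X
      ≡⟨ cong₂ (λ a b → 2 * a + b) (length-filter-T? (is-c 1) 𝒮) (length-filter-T? (is-c 3) 𝒮) ⟩
    2 * sum (map (ind ∘ is-c 1) 𝒮) + sum (map (ind ∘ is-c 3) 𝒮)
      ≡⟨ cong (_+ sum (map (ind ∘ is-c 3) 𝒮)) (sym (sum-map-*ˡ 𝒮 2 (ind ∘ is-c 1))) ⟩
    sum (map (λ C → 2 * ind (is-c 1 C)) 𝒮) + sum (map (ind ∘ is-c 3) 𝒮)
      ≡⟨ sym (sum-map-+ 𝒮 (λ C → 2 * ind (is-c 1 C)) (ind ∘ is-c 3)) ⟩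
    sum (map demand 𝒮) ∎
    where
    open ≡-Reasoning
    𝒮 : List (Subset n)
    𝒮 = allSubsets n
    is-c : ℕ → Subset n → Bool
    is-c i C = isComponentᵇ G X C ∧ (∣ C ∣ ≡ᵇ i)

proposition1 : ∀ (n : ℕ) (G : Graph n) → P2P5Factor G →
    ∀ (X : Subset n) → 2 * c G 1 X + c G 3 X ≤ 3 * ∣ X ∣
proposition1 n G F X = begin
  2 * c G 1 X + c G 3 X                      ≡⟨ 2c₁+c₃≡∑demand F X ⟩
  sum (map (demand F X) 𝒮)                   ≤⟨ sum-map-mono-≤ 𝒮 (demand≤componentCharge F X) ⟩
  sum (map (componentCharge F X) 𝒮)          ≤⟨ components-charge≤total F X ⟩
  ∑[ v < n ] vertexCharge F X v              ≤⟨ total-charge≤3∣X∣ F X ⟩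
  3 * ∣ X ∣                                  ∎
  where
  open ≤-Reasoning
  𝒮 : List (Subset n)
  𝒮 = allSubsets n
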